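{- Let $p$ be a sufficiently large prime and let $\mathcal{H}$ be the $3$-uniform hypergraph defined below. Then $\mathcal{H}$ contains no Berge $4$-cycle of type $(1,2,1,2)$; that is, there do not exist pairwise distinct vertices $w_1,w_2,w_3,w_4$ with $w_1,w_3\in V_1$, $w_2,w_4\in V_2$ and pairwise distinct edges $h_1,h_2,h_3,h_4$ of $\mathcal{H}$ with $\{w_1,w_2\}\subseteq h_1$, $\{w_2,w_3\}\subseteq h_2$, $\{w_3,w_4\}\subseteq h_3$, $\{w_4,w_1\}\subseteq h_4$.
   Context: Let $p$ be a sufficiently large prime and $\mathbb{F}_p$ the field with $p$ elements; $1/a$ denotes the inverse in $\mathbb{F}_p$, and elements of $\mathbb{F}_p$ are identified with $\{0,1,\dots,p-1\}$. Define $T_1=\{x: 2\le x\le \frac{p-1}{2}\}$, $T_2=\{x:\frac{p+3}{2}\le x\le p-1\}$, $T_3=\mathbb{F}_p\setminus\{ -x^2: x\in\mathbb{F}_p\}$, $T_4=\{x: x^2-4x+1=0\}\cup\{x:3x-1=0\}\cup\{x:3x-2=0\}$, $T_5=\{x: x^5-\frac{12757}{10872}x^4+\frac{1123}{3624}x^3+\frac{289}{1359}x^2-\frac{49}{453}x-\frac{2}{151}=0\}$. Fix $i_0\in\{1,2\}$ with $|T_{i_0}\cap T_3|\ge \frac{p-7}{4}$, and let $S_1=(T_{i_0}\cap T_3)\setminus(T_4\cup T_5)$ and $S_2=\mathbb{F}_p\setminus\{0,1\}$. For $i=1,2,3$ let $V_i=S_1\times S_2\times S_2\times\{i\}$. For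 $x_1,x_2,x_3\in S_1$ and $a\in\mathbb{F}_p^*$ let $e(x_1,x_2,x_3,a)=\{(x_1,x_2x_3+a,x_2^2x_3+a,1),\ (x_2,x_3x_1+a,x_3^2x_1+a,2),\ (x_3,x_1x_2+a,x_1^2x_2+a,3)\}$. $\mathcal{H}$ is the $3$-uniform hypergraph with vertex set $V_1\cup V_2\cup V_3$ and edge set $\{e(x_1,x_2,x_3,a): x_1,x_2,x_3\in S_1,\ a\in\mathbb{F}_p^*,\ e(x_1,x_2,x_3,a)\subseteq V_1\cup V_2\cup V_3\}$. -}

module Defs where

open import Data.Nat using (ℕ; zero; suc; _+_; _*_; _∸_; _^_; _≤_; _<_; NonZero)
open import Data.Nat.DivMod using (_/_; _%_)
open import Data.Product using (Σ; ∃; _×_; _,_)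
open import Data.Sum using (_⊎_)
open import Data.Empty using (⊥)
open import Data.List using (List; length)
open import Data.List.Relation.Unary.All using (All)
open import Data.List.Relation.Unary.Unique.Propositional using (Unique)
open import Relation.Nullary using (¬_)
open import Relation.Binary.PropositionalEquality using (_≡_; _≢_)

-- Arithmetic in F_p, with F_p identified with {0,1,...,p-1} ⊆ ℕ.
-- Numerals (possibly ≥ p) are read as their residues mod p.
module Fp (p : ℕ) .{{_ : NonZero p}} where

  InF : ℕ → Set
  InF x = x < p

  add : ℕ → ℕ → ℕ
  add a b = (a + b) % p

  mul : ℕ → ℕ → ℕ
  mul a b = (a * b) % p

  neg : ℕ → ℕ
  neg a = (p ∸ (a % p)) % p

  sub : ℕ → ℕ → ℕ
  sub a b = add a (neg b)

  pow : ℕ → ℕ → ℕ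
  pow a zero    = 1 % p
  pow a (suc n) = mul a (pow a n)

  -- multiplicative inverse in F_p (p prime): 1/a = a^(p-2)
  inv : ℕ → ℕ
  inv a = pow a (p ∸ 2)

  div : ℕ → ℕ → ℕ
  div a b = mul a (inv b)

  T1 : ℕ → Set
  T1 x = 2 ≤ x × x ≤ (p ∸ 1) / 2

  T2 : ℕ → Set
  T2 x = (p + 3) / 2 ≤ x × x ≤ p ∸ 1

  T3 : ℕ → Set
  T3 x = InF x × ¬ (Σ ℕ λ y → InF y × x ≡ neg (mul y y))

  T4 : ℕ → Set
  T4 x = InF x ×
         ( sub (add (mul x x) 1) (mul 4 x) ≡ 0
         ⊎ sub (mul 3 x) 1 ≡ 0
         ⊎ sub (mul 3 x) 2 ≡ 0 )

  poly5 : ℕ → ℕ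
  poly5 x =
    sub (sub (add (add (sub (pow x 5)
                            (mul (div 12757 10872) (pow x 4)))
                       (mul (div 1123 3624) (pow x 3)))
                  (mul (div 289 1359) (pow x 2)))
             (mul (div 49 453) x))
        (div 2 151)

  T5 : ℕ → Set
  T5 x = InF x × poly5 x ≡ 0

  T : ℕ → ℕ → Set
  T 1 x = T1 x
  T 2 x = T2 x
  T _ x = ⊥

  -- |T_{i0} ∩ T3| ≥ (p-7)/4, i.e. there are k distinct elements of
  -- T_{i0} ∩ T3 with 4k ≥ p - 7 (read over the rationals/integers).
  CardCond : ℕ → Set
  CardCond i0 = Σ (List ℕ) λ l →
    Unique l × All (λ x → T i0 x × T3 x) l × p ≤ 4 * length l + 7

  S1 : ℕ → ℕ → Set
  S1 i0 x = T i0 x × T3 x × ¬ T4 x × ¬ T5 x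

  S2 : ℕ → Set
  S2 x = InF x × x ≢ 0 × x ≢ 1

  Vertex : Set
  Vertex = ℕ × ℕ × ℕ × ℕ

  InVi : ℕ → ℕ → Vertex → Set
  InVi i0 i (x , y , z , j) = S1 i0 x × S2 y × S2 z × j ≡ i

  InV : ℕ → Vertex → Set
  InV i0 v = InVi i0 1 v ⊎ InVi i0 2 v ⊎ InVi i0 3 v

  -- An edge is a 3-set with exactly one vertex of each index 1,2,3
  -- (the last coordinate), so it is faithfully represented by the
  -- ordered triple (its index-1, index-2, index-3 vertex).
  Edge : Set
  Edge = Vertex × Vertex × Vertex

  e : ℕ → ℕ → ℕ → ℕ → Edge
  e x1 x2 x3 a =
    ( (x1 , add (mul x2 x3) a , add (mul (mul x2 x2) x3) a , 1)
    , (x2 , add (mul x3 x1) a , add (mul (mul x3 x3) x1) a , 2)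
    , (x3 , add (mul x1 x2) a , add (mul (mul x1 x1) x2) a , 3) )

  _∈E_ : Vertex → Edge → Set
  v ∈E (u1 , u2 , u3) = v ≡ u1 ⊎ v ≡ u2 ⊎ v ≡ u3

  EdgeSubV : ℕ → Edge → Set
  EdgeSubV i0 (u1 , u2 , u3) = InV i0 u1 × InV i0 u2 × InV i0 u3

  IsEdge : ℕ → Edge → Set
  IsEdge i0 h = Σ ℕ λ x1 → Σ ℕ λ x2 → Σ ℕ λ x3 → Σ ℕ λ a →
    S1 i0 x1 × S1 i0 x2 × S1 i0 x3 × (1 ≤ a × a < p) ×
    EdgeSubV i0 (e x1 x2 x3 a) × h ≡ e x1 x2 x3 a

  BergeC4-1212 : ℕ → Set
  BergeC4-1212 i0 =
    Σ Vertex λ w1 → Σ Vertex λ w2 → Σ Vertex λ w3 → Σ Vertex λ w4 →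
    Σ Edge λ h1 → Σ Edge λ h2 → Σ Edge λ h3 → Σ Edge λ h4 →
      (w1 ≢ w2 × w1 ≢ w3 × w1 ≢ w4 × w2 ≢ w3 × w2 ≢ w4 × w3 ≢ w4)
    × (InVi i0 1 w1 × InVi i0 1 w3 × InVi i0 2 w2 × InVi i0 2 w4)
    × (h1 ≢ h2 × h1 ≢ h3 × h1 ≢ h4 × h2 ≢ h3 × h2 ≢ h4 × h3 ≢ h4)
    × (IsEdge i0 h1 × IsEdge i0 h2 × IsEdge i0 h3 × IsEdge i0 h4)
    × (w1 ∈E h1 × w2 ∈E h1)
    × (w2 ∈E h2 × w3 ∈E h2)
    × (w3 ∈E h3 × w4 ∈E h3)
    × (w4 ∈E h4 × w1 ∈E h4)

module Submission where

-- The four shared vertices of a Berge cycle w₁ h₁ w₂ h₂ w₃ h₃ w₄ h₄ of type (1,2,1,2) say that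
-- the maps (u, v, a) ↦ (u v + a, u² v + a) agree at four pairs of edge parameters. Subtracting
-- the two coordinates of each equation leaves (u² − u) v, and eliminating between the four
-- resulting relations forces either h₁ = h₄ or h₁ = h₂.

open import Defs
open import Data.Nat using (ℕ; _≤_; NonZero)
open import Data.Nat.Primality using (Prime)
open import Data.Product using (Σ)
open import Data.Sum using (_⊎_)
open import Relation.Nullary using (¬_)
open import Relation.Binary.PropositionalEquality using (_≡_)

import Data.Nat.Base as ℕ
open import Data.Nat.Base using (_<_; z<s; >-nonZero⁻¹)
open import Data.Nat.Properties using (_≤?_; ≤-trans; <-trans; ≤-<-trans; m∸n≤m; >⇒≢; +-monoˡ-≤)
open import Data.Nat.DivMod using (_%_; _/_; /-monoˡ-≤; m≡m%n+[m/n]*n; m<n⇒m%n≡m)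
import Data.Nat.Divisibility as ℕ
open import Data.Nat.Divisibility using (n∣m⇒m%n≡0)
open import Data.Nat.Primality using (euclidsLemma)
open import Data.Integer.Base using (ℤ; +_; 0ℤ; 1ℤ; _+_; _*_; _-_; -_; ∣_∣; _⊖_)
open import Data.Integer.Properties
  using (abs-*; pos-+; pos-*; +-injective; i-j≡0⇒i≡j; ∣i∣≡0⇒i≡0; m-n≡m⊖n; ∣⊖∣-≤; ∣⊖∣-≰; ∣m⊖n∣≡∣n⊖m∣)
open import Data.Integer.Divisibility.Signed
  using (_∣_; divides; ∣ᵤ⇒∣; ∣⇒∣ᵤ; ∣m⇒∣-m; ∣m∣n⇒∣m+n; ∣m∣n⇒∣m-n; ∣n⇒∣m*n)
open import Data.Integer.Tactic.RingSolver using (solve)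
open import Data.List.Base using (_∷_; [])
open import Data.Empty using (⊥-elim)
open import Data.Product.Base using (_×_; _,_; proj₁; proj₂)
open import Data.Sum.Base as Sum using (inj₁; inj₂)
open import Function.Base using (_∘_; id)
open import Level using (0ℓ)
open import Relation.Binary.Bundles using (Setoid)
open import Relation.Binary.Structures using (IsEquivalence)
open import Relation.Binary.PropositionalEquality using (_≢_; refl; subst; sym; trans; cong; module ≡-Reasoning)
import Relation.Binary.Reasoning.Setoid as SetoidReasoning
open import Relation.Nullary.Decidable using (yes; no)

module CongruenceModulo (p : ℕ) where

  infix 4 _≈_ _≉_

  -- A record rather than a function, so that x and y can be inferred from a proof.
  record _≈_ (x y : ℤ) : Set where
    constructor congruent
    field p∣x-y : + p ∣ x - y
  open _≈_ using (p∣x-y)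

  _≉_ : ℤ → ℤ → Set
  x ≉ y = ¬ x ≈ y

  ∣-resp-≡ : ∀ {x y} → x ≡ y → + p ∣ x → + p ∣ y
  ∣-resp-≡ = subst (+ p ∣_)

  ≈-refl : ∀ {x} → x ≈ x
  ≈-refl {x} = congruent (divides 0ℤ (solve (x ∷ [])))

  ≈-sym : ∀ {x y} → x ≈ y → y ≈ x
  ≈-sym {x} {y} (congruent x-y) =
    congruent (∣-resp-≡ {(- (x - y))} (solve (x ∷ y ∷ [])) (∣m⇒∣-m x-y))

  ≈-trans : ∀ {x y z} → x ≈ y → y ≈ z → x ≈ z
  ≈-trans {x} {y} {z} (congruent x-y) (congruent y-z) =
    congruent (∣-resp-≡ {(x - y) + (y - z)} (solve (x ∷ y ∷ z ∷ [])) (∣m∣n⇒∣m+n x-y y-z))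

  ≈-isEquivalence : IsEquivalence _≈_
  ≈-isEquivalence = record { refl = ≈-refl ; sym = ≈-sym ; trans = ≈-trans }

  ≈-setoid : Setoid 0ℓ 0ℓ
  ≈-setoid = record { isEquivalence = ≈-isEquivalence }

  ≡⇒≈ : ∀ {x y} → x ≡ y → x ≈ y
  ≡⇒≈ refl = ≈-refl

  +-cong : ∀ {x y u v} → x ≈ y → u ≈ v → x + u ≈ y + v
  +-cong {x} {y} {u} {v} (congruent x-y) (congruent u-v) = congruent
    (∣-resp-≡ {(x - y) + (u - v)} (solve (x ∷ y ∷ u ∷ v ∷ [])) (∣m∣n⇒∣m+n x-y u-v))

  -‿cong : ∀ {x y u v} → x ≈ y → u ≈ v → x - u ≈ y - v
  -‿cong {x} {y} {u} {v} (congruent x-y) (congruent u-v) = congruent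
    (∣-resp-≡ {(x - y) - (u - v)} (solve (x ∷ y ∷ u ∷ v ∷ [])) (∣m∣n⇒∣m-n x-y u-v))

  *-cong : ∀ {x y u v} → x ≈ y → u ≈ v → x * u ≈ y * v
  *-cong {x} {y} {u} {v} (congruent x-y) (congruent u-v) = congruent
    (∣-resp-≡ {u * (x - y) + y * (u - v)} (solve (x ∷ y ∷ u ∷ v ∷ []))
              (∣m∣n⇒∣m+n (∣n⇒∣m*n u x-y) (∣n⇒∣m*n y u-v)))

  *-congˡ : ∀ {x u v} → u ≈ v → x * u ≈ x * v
  *-congˡ {x} = *-cong {x} {x} ≈-refl

  ∣⇒≈0 : ∀ {x} → + p ∣ x → x ≈ 0ℤ
  ∣⇒≈0 {x} p∣x = congruent (∣-resp-≡ {x} (solve (x ∷ [])) p∣x)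

  ≈0⇒∣ : ∀ {x} → x ≈ 0ℤ → + p ∣ x
  ≈0⇒∣ {x} (congruent p∣x-0) = ∣-resp-≡ {x - 0ℤ} (solve (x ∷ [])) p∣x-0

  x≈y⇒x-y≈0 : ∀ {x y} → x ≈ y → x - y ≈ 0ℤ
  x≈y⇒x-y≈0 = ∣⇒≈0 ∘ p∣x-y

  x-y≈0⇒x≈y : ∀ {x y} → x - y ≈ 0ℤ → x ≈ y
  x-y≈0⇒x≈y = congruent ∘ ≈0⇒∣


  module _ (prime : Prime p) where

    x*y≈0⇒x≈0⊎y≈0 : ∀ {x y} → x * y ≈ 0ℤ → x ≈ 0ℤ ⊎ y ≈ 0ℤ
    x*y≈0⇒x≈0⊎y≈0 {x} {y} xy≈0
      with euclidsLemma ∣ x ∣ ∣ y ∣ prime (subst (p ℕ.∣_) (abs-* x y) (∣⇒∣ᵤ (≈0⇒∣ xy≈0)))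
    ... | inj₁ p∣x = inj₁ (∣⇒≈0 (∣ᵤ⇒∣ p∣x))
    ... | inj₂ p∣y = inj₂ (∣⇒≈0 (∣ᵤ⇒∣ p∣y))

    x*y≉0 : ∀ {x y} → x ≉ 0ℤ → y ≉ 0ℤ → x * y ≉ 0ℤ
    x*y≉0 x≉0 y≉0 = Sum.[ x≉0 , y≉0 ]′ ∘ x*y≈0⇒x≈0⊎y≈0

    x*y≈0⇒y≈0 : ∀ {x y} → x ≉ 0ℤ → x * y ≈ 0ℤ → y ≈ 0ℤ
    x*y≈0⇒y≈0 x≉0 = Sum.[ ⊥-elim ∘ x≉0 , id ]′ ∘ x*y≈0⇒x≈0⊎y≈0

    *-cancelˡ-≈ : ∀ {x y z} → x ≉ 0ℤ → x * y ≈ x * z → y ≈ z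
    *-cancelˡ-≈ {x} {y} {z} x≉0 xy≈xz = x-y≈0⇒x≈y (x*y≈0⇒y≈0 x≉0 (begin
      x * (y - z)   ≡⟨ solve (x ∷ y ∷ z ∷ []) ⟩
      x * y - x * z ≈⟨ x≈y⇒x-y≈0 xy≈xz ⟩
      0ℤ            ∎))
      where open SetoidReasoning ≈-setoid

    x*x-x≉0 : ∀ {x} → x ≉ 0ℤ → x ≉ 1ℤ → x * x - x ≉ 0ℤ
    x*x-x≉0 {x} x≉0 x≉1 x²-x≈0 = x*y≉0 x≉0 x-1≉0 x[x-1]≈0
      where
      open SetoidReasoning ≈-setoid
      x-1≉0 : x - 1ℤ ≉ 0ℤ
      x-1≉0 = x≉1 ∘ x-y≈0⇒x≈y
      x[x-1]≈0 : x * (x - 1ℤ) ≈ 0ℤ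
      x[x-1]≈0 = begin
        x * (x - 1ℤ) ≡⟨ solve (x ∷ []) ⟩
        x * x - x    ≈⟨ x²-x≈0 ⟩
        0ℤ           ∎

module CycleAlgebra (p : ℕ) (prime : Prime p) where

  open CongruenceModulo p
  open SetoidReasoning ≈-setoid

  -- (u v + a, u² v + a) are the last two coordinates of the vertex of index i of
  -- e(x₁, x₂, x₃, a), where (u, v) = (xᵢ₊₁, xᵢ₊₂) with indices mod 3.
  record CoordinatesAgree (u v a u′ v′ a′ : ℤ) : Set where
    constructor _,_
    field
      linear    : u * v + a ≈ u′ * v′ + a′
      quadratic : u * u * v + a ≈ u′ * u′ * v′ + a′
  open CoordinatesAgree

  agree⇒[u²-u]v≈[u′²-u′]v′ : ∀ {u v a u′ v′ a′} → CoordinatesAgree u v a u′ v′ a′ →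
                             (u * u - u) * v ≈ (u′ * u′ - u′) * v′
  agree⇒[u²-u]v≈[u′²-u′]v′ {u} {v} {a} {u′} {v′} {a′} agree = begin
    (u * u - u) * v                           ≡⟨ solve (u ∷ v ∷ a ∷ []) ⟩
    (u * u * v + a) - (u * v + a)             ≈⟨ -‿cong (quadratic agree) (linear agree) ⟩
    (u′ * u′ * v′ + a′) - (u′ * v′ + a′)      ≡⟨ solve (u′ ∷ v′ ∷ a′ ∷ []) ⟩
    (u′ * u′ - u′) * v′                       ∎

  agree⇒v≈v′∧a≈a′ : ∀ {u v a u′ v′ a′} → CoordinatesAgree u v a u′ v′ a′ →
                     u ≈ u′ → u ≉ 0ℤ → u ≉ 1ℤ → v ≈ v′ × a ≈ a′
  agree⇒v≈v′∧a≈a′ {u} {v} {a} {u′} {v′} {a′} agree u≈u′ u≉0 u≉1 =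
    v≈v′ , a≈a′
    where
    v≈v′ : v ≈ v′
    v≈v′ = *-cancelˡ-≈ prime (x*x-x≉0 prime u≉0 u≉1) (begin
      (u * u - u) * v     ≈⟨ agree⇒[u²-u]v≈[u′²-u′]v′ agree ⟩
      (u′ * u′ - u′) * v′ ≈⟨ *-cong (-‿cong (*-cong u≈u′ u≈u′) u≈u′) (≈-refl {v′}) ⟨
      (u * u - u) * v′    ∎)
    a≈a′ : a ≈ a′
    a≈a′ = begin
      a                         ≡⟨ solve (u ∷ v ∷ a ∷ []) ⟩
      (u * v + a) - u * v       ≈⟨ -‿cong (linear agree) (*-cong u≈u′ v≈v′) ⟩
      (u′ * v′ + a′) - u′ * v′  ≡⟨ solve (u′ ∷ v′ ∷ a′ ∷ []) ⟩
      a′                        ∎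

  eliminate-z₃z₄ : ∀ A C z₁ z₂ z₃ z₄ β δ →
    β * z₁ ≈ δ * z₄ → β * z₂ ≈ δ * z₃ → (z₃ * z₃ - z₃) * C ≈ (z₄ * z₄ - z₄) * A →
    β * (β * (C * z₂ * z₂ - A * z₁ * z₁) - δ * (C * z₂ - A * z₁)) ≈ 0ℤ
  eliminate-z₃z₄ A C z₁ z₂ z₃ z₄ β δ βz₁≈δz₄ βz₂≈δz₃ w₄′ = begin
    β * (β * (C * z₂ * z₂ - A * z₁ * z₁) - δ * (C * z₂ - A * z₁))
      ≡⟨ solve (A ∷ C ∷ z₁ ∷ z₂ ∷ β ∷ δ ∷ []) ⟩
    C * (β * z₂ * (β * z₂) - δ * (β * z₂)) - A * (β * z₁ * (β * z₁) - δ * (β * z₁))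
      ≈⟨ -‿cong (*-congˡ {C} (g-cong βz₂≈δz₃)) (*-congˡ {A} (g-cong βz₁≈δz₄)) ⟩
    C * (δ * z₃ * (δ * z₃) - δ * (δ * z₃)) - A * (δ * z₄ * (δ * z₄) - δ * (δ * z₄))
      ≡⟨ solve (A ∷ C ∷ z₃ ∷ z₄ ∷ δ ∷ []) ⟩
    δ * δ * ((z₃ * z₃ - z₃) * C - (z₄ * z₄ - z₄) * A)
      ≈⟨ *-congˡ {δ * δ} (x≈y⇒x-y≈0 w₄′) ⟩
    δ * δ * 0ℤ
      ≡⟨ solve (δ ∷ []) ⟩
    0ℤ ∎
    where
    g-cong : ∀ {s t} → s ≈ t → s * s - δ * s ≈ t * t - δ * t
    g-cong s≈t = -‿cong (*-cong s≈t s≈t) (*-congˡ {δ} s≈t)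

  Cz₂-Az₁≈Cz₂²-Az₁² : ∀ A C z₁ z₂ → (z₁ * z₁ - z₁) * A ≈ (z₂ * z₂ - z₂) * C →
                        C * z₂ - A * z₁ ≈ C * z₂ * z₂ - A * z₁ * z₁
  Cz₂-Az₁≈Cz₂²-Az₁² A C z₁ z₂ w₂′ = begin
    C * z₂ - A * z₁
      ≡⟨ solve (A ∷ C ∷ z₁ ∷ z₂ ∷ []) ⟩
    C * z₂ * z₂ - A * z₁ * z₁ + ((z₁ * z₁ - z₁) * A - (z₂ * z₂ - z₂) * C)
      ≈⟨ +-cong (≈-refl {C * z₂ * z₂ - A * z₁ * z₁}) (x≈y⇒x-y≈0 w₂′) ⟩
    C * z₂ * z₂ - A * z₁ * z₁ + 0ℤ
      ≡⟨ solve (A ∷ C ∷ z₁ ∷ z₂ ∷ []) ⟩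
    C * z₂ * z₂ - A * z₁ * z₁ ∎

  [β-δ][Cz₂²-Az₁²]≈0 : ∀ A C z₁ z₂ z₃ z₄ β δ → β ≉ 0ℤ →
    β * z₁ ≈ δ * z₄ → β * z₂ ≈ δ * z₃ →
    (z₁ * z₁ - z₁) * A ≈ (z₂ * z₂ - z₂) * C → (z₃ * z₃ - z₃) * C ≈ (z₄ * z₄ - z₄) * A →
    (β - δ) * (C * z₂ * z₂ - A * z₁ * z₁) ≈ 0ℤ
  [β-δ][Cz₂²-Az₁²]≈0 A C z₁ z₂ z₃ z₄ β δ β≉0 βz₁≈δz₄ βz₂≈δz₃ w₂′ w₄′ = begin
    (β - δ) * (C * z₂ * z₂ - A * z₁ * z₁)
      ≡⟨ solve (A ∷ C ∷ z₁ ∷ z₂ ∷ β ∷ δ ∷ []) ⟩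
    (β * (C * z₂ * z₂ - A * z₁ * z₁) - δ * (C * z₂ - A * z₁))
      + δ * ((C * z₂ - A * z₁) - (C * z₂ * z₂ - A * z₁ * z₁))
      ≈⟨ +-cong reduced (*-congˡ {δ} (x≈y⇒x-y≈0 (Cz₂-Az₁≈Cz₂²-Az₁² A C z₁ z₂ w₂′))) ⟩
    0ℤ + δ * 0ℤ
      ≡⟨ solve (δ ∷ []) ⟩
    0ℤ ∎
    where
    reduced : β * (C * z₂ * z₂ - A * z₁ * z₁) - δ * (C * z₂ - A * z₁) ≈ 0ℤ
    reduced = x*y≈0⇒y≈0 prime β≉0 (eliminate-z₃z₄ A C z₁ z₂ z₃ z₄ β δ βz₁≈δz₄ βz₂≈δz₃ w₄′)

  Cz₂²-Az₁²≈0⇒z₁≈z₂ : ∀ A C z₁ z₂ → A ≉ 0ℤ → z₁ ≉ 0ℤ →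
    (z₁ * z₁ - z₁) * A ≈ (z₂ * z₂ - z₂) * C → C * z₂ * z₂ - A * z₁ * z₁ ≈ 0ℤ → z₁ ≈ z₂
  Cz₂²-Az₁²≈0⇒z₁≈z₂ A C z₁ z₂ A≉0 z₁≉0 w₂′ E≈0 =
    x-y≈0⇒x≈y (x*y≈0⇒y≈0 prime (x*y≉0 prime A≉0 z₁≉0) (begin
      A * z₁ * (z₁ - z₂)
        ≡⟨ solve (A ∷ C ∷ z₁ ∷ z₂ ∷ []) ⟩
      z₂ * (C * z₂ - A * z₁) - (C * z₂ * z₂ - A * z₁ * z₁)
        ≈⟨ -‿cong (*-congˡ {z₂} (≈-trans (Cz₂-Az₁≈Cz₂²-Az₁² A C z₁ z₂ w₂′) E≈0)) E≈0 ⟩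
      z₂ * 0ℤ - 0ℤ
        ≡⟨ solve (z₂ ∷ []) ⟩
      0ℤ ∎))

  -- Here and below the edges of the cycle are e(A, B, z₁, a₁), e(C, B, z₂, a₂), e(C, D, z₃, a₃)
  -- and e(A, D, z₄, a₄), and the four CoordinatesAgree hypotheses are its shared vertices.
  [B-D][z₁-z₂]≈0 : ∀ {A B C D z₁ z₂ z₃ z₄ a₁ a₂ a₃ a₄} →
    CoordinatesAgree B z₁ a₁ D z₄ a₄ → CoordinatesAgree z₁ A a₁ z₂ C a₂ →
    CoordinatesAgree B z₂ a₂ D z₃ a₃ → CoordinatesAgree z₃ C a₃ z₄ A a₄ →
    z₁ ≈ z₄ → z₂ ≈ z₃ → (B - D) * (z₁ - z₂) ≈ 0ℤ
  [B-D][z₁-z₂]≈0 {A} {B} {C} {D} {z₁} {z₂} {z₃} {z₄} {a₁} {a₂} {a₃} {a₄} w₁ w₂ w₃ w₄ z₁≈z₄ z₂≈z₃ = begin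
    (B - D) * (z₁ - z₂)
      ≡⟨ solve (A ∷ B ∷ C ∷ D ∷ z₁ ∷ z₂ ∷ z₃ ∷ z₄ ∷ a₁ ∷ a₂ ∷ a₃ ∷ a₄ ∷ []) ⟩
    ((B * z₁ + a₁) + (z₂ * C + a₂) + (D * z₃ + a₃) + (z₄ * A + a₄))
      - ((D * z₄ + a₄) + (z₁ * A + a₁) + (B * z₂ + a₂) + (z₃ * C + a₃))
      + (A - D) * (z₁ - z₄) + (D - C) * (z₂ - z₃)
      ≈⟨ +-cong (+-cong (x≈y⇒x-y≈0 sides) (*-congˡ {A - D} (x≈y⇒x-y≈0 z₁≈z₄)))
                (*-congˡ {D - C} (x≈y⇒x-y≈0 z₂≈z₃)) ⟩
    0ℤ + (A - D) * 0ℤ + (D - C) * 0ℤ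
      ≡⟨ solve (A ∷ C ∷ D ∷ []) ⟩
    0ℤ ∎
    where
    sides : (B * z₁ + a₁) + (z₂ * C + a₂) + (D * z₃ + a₃) + (z₄ * A + a₄)
          ≈ (D * z₄ + a₄) + (z₁ * A + a₁) + (B * z₂ + a₂) + (z₃ * C + a₃)
    sides = +-cong (+-cong (+-cong (linear w₁) (≈-sym (linear w₂))) (≈-sym (linear w₃)))
                   (≈-sym (linear w₄))

  -- With β = B² − B and δ = D² − D, eliminating z₃ and z₄ gives (β − δ)(C z₂² − A z₁²) ≈ 0.
  -- If β ≈ δ then z₁ ≈ z₄ and z₂ ≈ z₃, and the linear coordinates telescope to (B − D)(z₁ − z₂) ≈ 0.
  cycle⇒B≈D⊎z₁≈z₂ : ∀ {A B C D z₁ z₂ z₃ z₄ a₁ a₂ a₃ a₄} →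
    CoordinatesAgree B z₁ a₁ D z₄ a₄ → CoordinatesAgree z₁ A a₁ z₂ C a₂ →
    CoordinatesAgree B z₂ a₂ D z₃ a₃ → CoordinatesAgree z₃ C a₃ z₄ A a₄ →
    A ≉ 0ℤ → B ≉ 0ℤ → B ≉ 1ℤ → D ≉ 0ℤ → D ≉ 1ℤ → z₁ ≉ 0ℤ → B ≈ D ⊎ z₁ ≈ z₂
  cycle⇒B≈D⊎z₁≈z₂ {A} {B} {C} {D} {z₁} {z₂} {z₃} {z₄} w₁ w₂ w₃ w₄ A≉0 B≉0 B≉1 D≉0 D≉1 z₁≉0 =
    Sum.[ β≈δ⇒B≈D⊎z₁≈z₂ , (λ E≈0 → inj₂ (Cz₂²-Az₁²≈0⇒z₁≈z₂ A C z₁ z₂ A≉0 z₁≉0 w₂′ E≈0)) ]′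
      (x*y≈0⇒x≈0⊎y≈0 prime
        ([β-δ][Cz₂²-Az₁²]≈0 A C z₁ z₂ z₃ z₄ (B * B - B) (D * D - D)
           (x*x-x≉0 prime B≉0 B≉1) w₁′ w₃′ w₂′ w₄′))
    where
    w₁′ : (B * B - B) * z₁ ≈ (D * D - D) * z₄
    w₁′ = agree⇒[u²-u]v≈[u′²-u′]v′ w₁
    w₂′ : (z₁ * z₁ - z₁) * A ≈ (z₂ * z₂ - z₂) * C
    w₂′ = agree⇒[u²-u]v≈[u′²-u′]v′ w₂
    w₃′ : (B * B - B) * z₂ ≈ (D * D - D) * z₃
    w₃′ = agree⇒[u²-u]v≈[u′²-u′]v′ w₃
    w₄′ : (z₃ * z₃ - z₃) * C ≈ (z₄ * z₄ - z₄) * A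
    w₄′ = agree⇒[u²-u]v≈[u′²-u′]v′ w₄
    β≈δ⇒B≈D⊎z₁≈z₂ : (B * B - B) - (D * D - D) ≈ 0ℤ → B ≈ D ⊎ z₁ ≈ z₂
    β≈δ⇒B≈D⊎z₁≈z₂ β-δ≈0 = Sum.map x-y≈0⇒x≈y x-y≈0⇒x≈y
      (x*y≈0⇒x≈0⊎y≈0 prime ([B-D][z₁-z₂]≈0 w₁ w₂ w₃ w₄ (cancel w₁′) (cancel w₃′)))
      where
      β≈δ : B * B - B ≈ D * D - D
      β≈δ = x-y≈0⇒x≈y β-δ≈0
      cancel : ∀ {u v} → (B * B - B) * u ≈ (D * D - D) * v → u ≈ v
      cancel {u} βu≈δv = *-cancelˡ-≈ prime (x*x-x≉0 prime D≉0 D≉1)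
        (≈-trans (*-cong (≈-sym β≈δ) (≈-refl {u})) βu≈δv)

  cycle-collapses : ∀ {A B C D z₁ z₂ z₃ z₄ a₁ a₂ a₃ a₄} →
    CoordinatesAgree B z₁ a₁ D z₄ a₄ → CoordinatesAgree z₁ A a₁ z₂ C a₂ →
    CoordinatesAgree B z₂ a₂ D z₃ a₃ → CoordinatesAgree z₃ C a₃ z₄ A a₄ →
    A ≉ 0ℤ → B ≉ 0ℤ → B ≉ 1ℤ → D ≉ 0ℤ → D ≉ 1ℤ → z₁ ≉ 0ℤ → z₁ ≉ 1ℤ →
    (B ≈ D × z₁ ≈ z₄ × a₁ ≈ a₄) ⊎ (z₁ ≈ z₂ × A ≈ C × a₁ ≈ a₂)
  cycle-collapses w₁ w₂ w₃ w₄ A≉0 B≉0 B≉1 D≉0 D≉1 z₁≉0 z₁≉1 =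
    Sum.map (λ B≈D → B≈D , agree⇒v≈v′∧a≈a′ w₁ B≈D B≉0 B≉1)
            (λ z₁≈z₂ → z₁≈z₂ , agree⇒v≈v′∧a≈a′ w₂ z₁≈z₂ z₁≉0 z₁≉1)
            (cycle⇒B≈D⊎z₁≈z₂ w₁ w₂ w₃ w₄ A≉0 B≉0 B≉1 D≉0 D≉1 z₁≉0)

module Residues (p : ℕ) .{{_ : NonZero p}} where

  open CongruenceModulo p
  open Fp p using (add; mul)

  m%p≈m : ∀ m → + (m % p) ≈ + m
  m%p≈m m = congruent (divides (- + (m / p)) (begin
    + (m % p) - + m
      ≡⟨ cong (λ k → + (m % p) - + k) (m≡m%n+[m/n]*n m p) ⟩
    + (m % p) - + (m % p ℕ.+ m / p ℕ.* p)
      ≡⟨ cong (λ k → + (m % p) - k) (pos-+ (m % p) (m / p ℕ.* p)) ⟩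
    + (m % p) - (+ (m % p) + + (m / p ℕ.* p))
      ≡⟨ cong (λ k → + (m % p) - (+ (m % p) + k)) (pos-* (m / p) p) ⟩
    + (m % p) - (+ (m % p) + + (m / p) * + p)
      ≡⟨ r-[r+qn]≡-qn (+ (m % p)) (+ (m / p)) (+ p) ⟩
    - + (m / p) * + p ∎))
    where
    open ≡-Reasoning
    r-[r+qn]≡-qn : ∀ r q n → r - (r + q * n) ≡ - q * n
    r-[r+qn]≡-qn r q n = solve (r ∷ q ∷ n ∷ [])

  add-≈ : ∀ m n → + add m n ≈ + m + + n
  add-≈ m n = ≈-trans (m%p≈m (m ℕ.+ n)) (≡⇒≈ (pos-+ m n))

  mul-≈ : ∀ m n → + mul m n ≈ + m * + n
  mul-≈ m n = ≈-trans (m%p≈m (m ℕ.* n)) (≡⇒≈ (pos-* m n))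

  ∣+m-+n∣<p : ∀ {m n} → m < p → n < p → ∣ + m - + n ∣ < p
  ∣+m-+n∣<p {m} {n} m<p n<p = subst (λ k → ∣ k ∣ < p) (sym (m-n≡m⊖n m n)) ∣m⊖n∣<p
    where
    ∣m⊖n∣<p : ∣ m ⊖ n ∣ < p
    ∣m⊖n∣<p with m ≤? n
    ... | yes m≤n = subst (_< p) (sym (∣⊖∣-≤ m≤n)) (≤-<-trans (m∸n≤m n m) n<p)
    ... | no  m≰n = subst (_< p) (sym (trans (∣m⊖n∣≡∣n⊖m∣ m n) (∣⊖∣-≰ m≰n)))
                          (≤-<-trans (m∸n≤m m n) m<p)

  +≈+⇒≡ : ∀ {m n} → m < p → n < p → + m ≈ + n → m ≡ n
  +≈+⇒≡ {m} {n} m<p n<p (congruent p∣m-n) =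
    +-injective (i-j≡0⇒i≡j (+ m) (+ n) (∣i∣≡0⇒i≡0 (begin
      ∣ + m - + n ∣      ≡⟨ m<n⇒m%n≡m (∣+m-+n∣<p m<p n<p) ⟨
      ∣ + m - + n ∣ % p  ≡⟨ n∣m⇒m%n≡0 _ p (∣⇒∣ᵤ p∣m-n) ⟩
      0                  ∎)))
    where open ≡-Reasoning

  +≉+ : ∀ {m n} → m < p → n < p → m ≢ n → + m ≉ + n
  +≉+ m<p n<p m≢n = m≢n ∘ +≈+⇒≡ m<p n<p

module BergeCycle (p : ℕ) .{{_ : NonZero p}} (prime : Prime p) where

  open Fp p
  open CongruenceModulo p
  open Residues p
  open CycleAlgebra p prime

  vertex : ℕ → ℕ → ℕ → ℕ → ℕ → Vertex
  vertex i x u v a = x , add (mul u v) a , add (mul (mul u u) v) a , i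

  linear-≈ : ∀ u v a → + add (mul u v) a ≈ + u * + v + + a
  linear-≈ u v a = ≈-trans (add-≈ (mul u v) a) (+-cong (mul-≈ u v) (≈-refl {+ a}))

  quadratic-≈ : ∀ u v a → + add (mul (mul u u) v) a ≈ + u * + u * + v + + a
  quadratic-≈ u v a = ≈-trans (add-≈ (mul (mul u u) v) a)
    (+-cong (≈-trans (mul-≈ (mul u u) v) (*-cong (mul-≈ u u) (≈-refl {+ v}))) (≈-refl {+ a}))

  shared-vertex : ∀ {i x u v a x′ u′ v′ a′} → vertex i x u v a ≡ vertex i x′ u′ v′ a′ →
                  x ≡ x′ × CoordinatesAgree (+ u) (+ v) (+ a) (+ u′) (+ v′) (+ a′)
  shared-vertex {u = u} {v} {a} {u′ = u′} {v′} {a′} eq =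
    cong proj₁ eq ,
    (via (cong (proj₁ ∘ proj₂) eq) (linear-≈ u v a) (linear-≈ u′ v′ a′) ,
     via (cong (proj₁ ∘ proj₂ ∘ proj₂) eq) (quadratic-≈ u v a) (quadratic-≈ u′ v′ a′))
    where
    via : ∀ {m m′ X X′} → m ≡ m′ → + m ≈ X → + m′ ≈ X′ → X ≈ X′
    via refl m≈X m≈X′ = ≈-trans (≈-sym m≈X) m≈X′

  ∈E⇒≡vertex₁ : ∀ {i0 w x₁ x₂ x₃ a} → InVi i0 1 w → w ∈E e x₁ x₂ x₃ a → w ≡ vertex 1 x₁ x₂ x₃ a
  ∈E⇒≡vertex₁ (_ , _ , _ , refl) (inj₁ w≡)         = w≡
  ∈E⇒≡vertex₁ (_ , _ , _ , refl) (inj₂ (inj₁ ()))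
  ∈E⇒≡vertex₁ (_ , _ , _ , refl) (inj₂ (inj₂ ()))

  ∈E⇒≡vertex₂ : ∀ {i0 w x₁ x₂ x₃ a} → InVi i0 2 w → w ∈E e x₁ x₂ x₃ a → w ≡ vertex 2 x₂ x₃ x₁ a
  ∈E⇒≡vertex₂ (_ , _ , _ , refl) (inj₁ ())
  ∈E⇒≡vertex₂ (_ , _ , _ , refl) (inj₂ (inj₁ w≡)) = w≡
  ∈E⇒≡vertex₂ (_ , _ , _ , refl) (inj₂ (inj₂ ()))

  e-cong : ∀ {x₁ x₂ x₃ a y₁ y₂ y₃ b} →
           x₁ ≡ y₁ → x₂ ≡ y₂ → x₃ ≡ y₃ → a ≡ b → e x₁ x₂ x₃ a ≡ e y₁ y₂ y₃ b
  e-cong refl refl refl refl = refl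

  S1⇒2≤ : ∀ {i0 x} → i0 ≡ 1 ⊎ i0 ≡ 2 → S1 i0 x → 2 ≤ x
  S1⇒2≤ (inj₁ refl) ((2≤x , _) , _) = 2≤x
  S1⇒2≤ (inj₂ refl) ((p+3/2≤x , _) , _) =
    ≤-trans (/-monoˡ-≤ 2 (+-monoˡ-≤ 3 (>-nonZero⁻¹ p))) p+3/2≤x

  S1⇒<p : ∀ {i0 x} → S1 i0 x → x < p
  S1⇒<p (_ , (x<p , _) , _) = x<p

  +x≉0 : ∀ {x} → 2 ≤ x → x < p → + x ≉ 0ℤ
  +x≉0 2≤x x<p = +≉+ x<p (>-nonZero⁻¹ p) (>⇒≢ (<-trans z<s 2≤x))

  +x≉1 : ∀ {x} → 2 ≤ x → x < p → + x ≉ 1ℤ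
  +x≉1 2≤x x<p = +≉+ x<p (<-trans 2≤x x<p) (>⇒≢ 2≤x)

  EdgeParameters : ℕ → ℕ → ℕ → ℕ → ℕ → Set
  EdgeParameters i0 x₁ x₂ x₃ a = S1 i0 x₁ × S1 i0 x₂ × S1 i0 x₃ × a < p

  edges-coincide : ∀ {i0} → i0 ≡ 1 ⊎ i0 ≡ 2 → ∀ {x₁ x₂ x₃ a y₁ y₂ y₃ b z₁ z₂ z₃ c t₁ t₂ t₃ d} →
    EdgeParameters i0 x₁ x₂ x₃ a → EdgeParameters i0 y₁ y₂ y₃ b →
    EdgeParameters i0 z₁ z₂ z₃ c → EdgeParameters i0 t₁ t₂ t₃ d →
    x₁ ≡ t₁ × CoordinatesAgree (+ x₂) (+ x₃) (+ a) (+ t₂) (+ t₃) (+ d) →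
    x₂ ≡ y₂ × CoordinatesAgree (+ x₃) (+ x₁) (+ a) (+ y₃) (+ y₁) (+ b) →
    y₁ ≡ z₁ × CoordinatesAgree (+ y₂) (+ y₃) (+ b) (+ z₂) (+ z₃) (+ c) →
    z₂ ≡ t₂ × CoordinatesAgree (+ z₃) (+ z₁) (+ c) (+ t₃) (+ t₁) (+ d) →
    e x₁ x₂ x₃ a ≡ e t₁ t₂ t₃ d ⊎ e x₁ x₂ x₃ a ≡ e y₁ y₂ y₃ b
  edges-coincide i0∈ (x₁∈S₁ , x₂∈S₁ , x₃∈S₁ , a<p) (y₁∈S₁ , _ , y₃∈S₁ , b<p)
                     (_ , z₂∈S₁ , _ , _) (_ , _ , t₃∈S₁ , d<p)
                     (refl , agree₁) (refl , agree₂) (refl , agree₃) (refl , agree₄) =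
    Sum.map
      (λ { (x₂≈z₂ , x₃≈t₃ , a≈d) →
             e-cong refl (≈⇒≡ x₂∈S₁ z₂∈S₁ x₂≈z₂) (≈⇒≡ x₃∈S₁ t₃∈S₁ x₃≈t₃) (+≈+⇒≡ a<p d<p a≈d) })
      (λ { (x₃≈y₃ , x₁≈y₁ , a≈b) →
             e-cong (≈⇒≡ x₁∈S₁ y₁∈S₁ x₁≈y₁) refl (≈⇒≡ x₃∈S₁ y₃∈S₁ x₃≈y₃) (+≈+⇒≡ a<p b<p a≈b) })
      (cycle-collapses agree₁ agree₂ agree₃ agree₄
        (≉0 x₁∈S₁) (≉0 x₂∈S₁) (≉1 x₂∈S₁) (≉0 z₂∈S₁) (≉1 z₂∈S₁) (≉0 x₃∈S₁) (≉1 x₃∈S₁))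
    where
    ≈⇒≡ : ∀ {x y} → S1 _ x → S1 _ y → + x ≈ + y → x ≡ y
    ≈⇒≡ x∈S₁ y∈S₁ = +≈+⇒≡ (S1⇒<p x∈S₁) (S1⇒<p y∈S₁)
    ≉0 : ∀ {x} → S1 _ x → + x ≉ 0ℤ
    ≉0 x∈S₁ = +x≉0 (S1⇒2≤ i0∈ x∈S₁) (S1⇒<p x∈S₁)
    ≉1 : ∀ {x} → S1 _ x → + x ≉ 1ℤ
    ≉1 x∈S₁ = +x≉1 (S1⇒2≤ i0∈ x∈S₁) (S1⇒<p x∈S₁)

  no-Berge-C4-1212 : ∀ {i0} → i0 ≡ 1 ⊎ i0 ≡ 2 → ¬ BergeC4-1212 i0
  no-Berge-C4-1212 i0∈
    (w₁ , w₂ , w₃ , w₄ , _ , _ , _ , _ , _ , (w₁∈V₁ , w₃∈V₁ , w₂∈V₂ , w₄∈V₂) ,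
     (h₁≢h₂ , _ , h₁≢h₄ , _ , _ , _) ,
     ( (_ , _ , _ , _ , x₁∈S₁ , x₂∈S₁ , x₃∈S₁ , (_ , a<p) , _ , refl)
     , (_ , _ , _ , _ , y₁∈S₁ , y₂∈S₁ , y₃∈S₁ , (_ , b<p) , _ , refl)
     , (_ , _ , _ , _ , z₁∈S₁ , z₂∈S₁ , z₃∈S₁ , (_ , c<p) , _ , refl)
     , (_ , _ , _ , _ , t₁∈S₁ , t₂∈S₁ , t₃∈S₁ , (_ , d<p) , _ , refl) ) ,
     (w₁∈h₁ , w₂∈h₁) , (w₂∈h₂ , w₃∈h₂) , (w₃∈h₃ , w₄∈h₃) , (w₄∈h₄ , w₁∈h₄)) =
    Sum.[ h₁≢h₄ , h₁≢h₂ ]′ (edges-coincide i0∈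
      (x₁∈S₁ , x₂∈S₁ , x₃∈S₁ , a<p) (y₁∈S₁ , y₂∈S₁ , y₃∈S₁ , b<p)
      (z₁∈S₁ , z₂∈S₁ , z₃∈S₁ , c<p) (t₁∈S₁ , t₂∈S₁ , t₃∈S₁ , d<p)
      (shared-vertex (trans (sym (∈E⇒≡vertex₁ w₁∈V₁ w₁∈h₁)) (∈E⇒≡vertex₁ w₁∈V₁ w₁∈h₄)))
      (shared-vertex (trans (sym (∈E⇒≡vertex₂ w₂∈V₂ w₂∈h₁)) (∈E⇒≡vertex₂ w₂∈V₂ w₂∈h₂)))
      (shared-vertex (trans (sym (∈E⇒≡vertex₁ w₃∈V₁ w₃∈h₂)) (∈E⇒≡vertex₁ w₃∈V₁ w₃∈h₃)))
      (shared-vertex (trans (sym (∈E⇒≡vertex₂ w₄∈V₂ w₄∈h₃)) (∈E⇒≡vertex₂ w₄∈V₂ w₄∈h₄))))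

lemma1 : Σ ℕ λ P0 → (p : ℕ) → .{{_ : NonZero p}} → Prime p → P0 ≤ p →
           (i0 : ℕ) → (i0 ≡ 1 ⊎ i0 ≡ 2) → Fp.CardCond p i0 →
           ¬ Fp.BergeC4-1212 p i0
lemma1 = 0 , λ p prime _ _ i0∈ _ → BergeCycle.no-Berge-C4-1212 p prime i0∈
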